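{- Let $q>2$ be even and let $\mathcal{E}$ be a set of solids of $\mathrm{PG}(4,q)$ such that every point of $\mathrm{PG}(4,q)$ lies in either $0$, $\frac12q^3$ or $\frac12(q^3-q^2)$ solids of $\mathcal{E}$, and every plane lies in either $0$, $\frac12q$ or $q$ solids of $\mathcal{E}$. If $|\mathcal{E}|=\frac12q^2(q^2-1)$, then every plane of $\mathrm{PG}(4,q)$ containing a red point contains exactly $q+1$ black points.
   Context: A solid of $\mathrm{PG}(4,q)$ is a hyperplane. A point is called red if it lies in $0$ solids of $\mathcal{E}$, and black if it lies in $\frac12(q^3-q^2)$ solids of $\mathcal{E}$. -}

module Defs where

open import Level using (0ℓ)
open import Data.Nat as ℕ using (ℕ; zero; suc)
open import Data.Nat.DivMod as DM using ()
open import Data.Bool using (Bool; true; false; _∧_; not; if_then_else_)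
open import Data.List using (List; []; _∷_; length; filterᵇ; map; concatMap; foldr)
open import Data.List.Membership.Propositional using (_∈_)
open import Data.List.Relation.Unary.Unique.Propositional using (Unique)
open import Data.List.Relation.Unary.All as All using (All)
open import Data.Vec using (Vec; []; _∷_)
open import Data.Product using (∃; _,_)
open import Relation.Binary.PropositionalEquality using (_≡_; _≢_)
open import Relation.Binary.Definitions using (DecidableEquality)
open import Relation.Nullary.Decidable using (⌊_⌋; does)
open import Algebra.Structures using (IsCommutativeRing)

record FiniteField : Set₁ where
  infixl 6 _+_
  infixl 7 _*_
  field
    Carrier   : Set
    _+_ _*_   : Carrier → Carrier → Carrier
    -_        : Carrier → Carrier
    0# 1#     : Carrier
    isCommutativeRing : IsCommutativeRing _≡_ _+_ _*_ -_ 0# 1#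
    0≢1       : 0# ≢ 1#
    inverse   : ∀ x → x ≢ 0# → ∃ λ y → x * y ≡ 1#
    _≟_       : DecidableEquality Carrier
    elems     : List Carrier
    complete  : ∀ x → x ∈ elems
    unique    : Unique elems

  order : ℕ
  order = length elems

module PG4 (F : FiniteField) where
  open FiniteField F

  allVecs : (n : ℕ) → List (Vec Carrier n)
  allVecs zero    = [] ∷ []
  allVecs (suc n) = concatMap (λ x → map (x ∷_) (allVecs n)) elems

  isZero : Carrier → Bool
  isZero x = ⌊ x ≟ 0# ⌋

  -- normalized: nonzero and the first nonzero coordinate equals 1.
  -- Every 1-dimensional subspace of F^n has exactly one normalized spanning vector.
  normalized : ∀ {n} → Vec Carrier n → Bool
  normalized []       = false
  normalized (x ∷ xs) = if isZero x then normalized xs else ⌊ x ≟ 1# ⌋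

  dot : ∀ {n} → Vec Carrier n → Vec Carrier n → Carrier
  dot []       []       = 0#
  dot (x ∷ xs) (y ∷ ys) = x * y + dot xs ys

  -- Points of PG(4,q): normalized vectors of F^5 (homogeneous coordinates).
  -- Solids (hyperplanes) of PG(4,q): normalized dual vectors of F^5 (a solid
  -- with coordinates s is the set of points P with s·P = 0).
  Vec5 : Set
  Vec5 = Vec Carrier 5

  points : List Vec5
  points = filterᵇ normalized (allVecs 5)

  solids : List Vec5
  solids = filterᵇ normalized (allVecs 5)

  onSolid : Vec5 → Vec5 → Bool
  onSolid s P = isZero (dot s P)

  -- A plane of PG(4,q) is the intersection of two distinct solids a, b
  -- (every plane arises this way); its points:
  planePoints : Vec5 → Vec5 → List Vec5
  planePoints a b = filterᵇ (λ P → onSolid a P ∧ onSolid b P) points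

  allᵇ : (Vec5 → Bool) → List Vec5 → Bool
  allᵇ p = foldr (λ x r → p x ∧ r) true

  planeInSolid : Vec5 → Vec5 → Vec5 → Bool
  planeInSolid a b s = allᵇ (onSolid s) (planePoints a b)

  SolidSet : Set
  SolidSet = Vec5 → Bool

  size : SolidSet → ℕ
  size E = length (filterᵇ E solids)

  pointDeg : SolidSet → Vec5 → ℕ
  pointDeg E P = length (filterᵇ (λ s → E s ∧ onSolid s P) solids)

  planeDeg : SolidSet → Vec5 → Vec5 → ℕ
  planeDeg E a b = length (filterᵇ (λ s → E s ∧ planeInSolid a b s) solids)

  q : ℕ
  q = order

  isRed : SolidSet → Vec5 → Set
  isRed E P = pointDeg E P ≡ 0

  isBlackᵇ : SolidSet → Vec5 → Bool
  isBlackᵇ E P = pointDeg E P ℕ.≡ᵇ ((q ℕ.^ 3 ℕ.∸ q ℕ.^ 2) DM./ 2)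

  blackPointsOnPlane : SolidSet → Vec5 → Vec5 → ℕ
  blackPointsOnPlane E a b = length (filterᵇ (isBlackᵇ E) (planePoints a b))

module Submission where

-- Let R be a red point of the plane π = a ∩ b.  No solid of ℰ contains R, so
-- each solid of ℰ meets each line ℓ through R in exactly one point and the
-- degrees of the points of ℓ sum to |ℰ|.  With q = m + 1 and q² = 2K the
-- admissible degrees are 0, Kq and Km (black) and |ℰ| = K·m(q + 1); if ℓ∖{R}
-- has x points of degree Kq and y black ones, then x + y ≤ q and
-- xq + ym = m(q + 1) force y = 1.  The q + 1 lines of π through R partition
-- π∖{R}, so π has q + 1 black points.  (The hypothesis on planes is unused.)
--
-- Points are normalised vectors of F⁵, so we count vectors: for v in the
-- 3-space V = {a·v = b·v = 0}, #{λ | v + λR black} + #{μ | v = μR} = 1.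
-- Summing over V (which is invariant under v ↦ v + λR) gives q³ = qX + q for
-- the number X of black vectors of V, and X = (q − 1)N for the number N of
-- black points of π, whence N = q + 1.  The modules below provide, in order:
-- finite sums, the arithmetic of q, K, m, linear algebra over F, normalised
-- representatives, sums over Fⁿ, sums regrouped by projective points, the
-- degree function of ℰ, and the count through a red point.

open import Defs

module ListSums where
  open import Data.Nat using (ℕ; zero; suc; _+_; _*_; _≤_; z≤n)
  open import Data.Nat.Properties
  open import Data.Nat.Tactic.RingSolver using (solve-∀)
  open import Data.Bool using (Bool; true; false; _∧_)
  open import Data.List using (List; []; _∷_; length; filterᵇ; map; concatMap; _++_)
  open import Data.List.Relation.Unary.Any using (here; there)
  open import Data.List.Relation.Unary.All using (All; []; _∷_)
  open import Data.List.Relation.Unary.AllPairs using (AllPairs; []; _∷_)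
  open import Data.List.Membership.Propositional using (_∈_)
  open import Data.Product using (∃; _,_)
  open import Relation.Binary.PropositionalEquality
  open import Relation.Binary.Definitions using (DecidableEquality)
  open import Relation.Nullary using (Dec; yes; no; does; ¬_)
  open import Relation.Nullary.Decidable using (dec-true; dec-false; isYes≗does; ⌊_⌋)
  open import Data.Empty using (⊥-elim)

  ∑ : ∀ {A : Set} → List A → (A → ℕ) → ℕ
  ∑ []       f = 0
  ∑ (x ∷ xs) f = f x + ∑ xs f

  -- Iverson brackets: 𝟙 b is 1 if b holds, δ d is 1 if the decision d is yes.
  -- δ is defined through 'does', which computes on the decidable equalities
  -- of ℕ and of vectors.
  𝟙 : Bool → ℕ
  𝟙 true  = 1
  𝟙 false = 0

  δ : ∀ {P : Set} → Dec P → ℕ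
  δ d = 𝟙 (does d)

  𝟙-∧ : ∀ a b → 𝟙 (a ∧ b) ≡ 𝟙 a * 𝟙 b
  𝟙-∧ true  b = sym (+-identityʳ (𝟙 b))
  𝟙-∧ false b = refl

  δ-iff : ∀ {P Q : Set} → (P → Q) → (Q → P) → (d : Dec P) (e : Dec Q) → δ d ≡ δ e
  δ-iff f g (yes p) (yes q) = refl
  δ-iff f g (yes p) (no ¬q) = ⊥-elim (¬q (f p))
  δ-iff f g (no ¬p) (yes q) = ⊥-elim (¬p (g q))
  δ-iff f g (no ¬p) (no ¬q) = refl

  δ-yes : ∀ {P : Set} (d : Dec P) → P → δ d ≡ 1
  δ-yes d p = cong 𝟙 (dec-true d p)

  δ-no : ∀ {P : Set} (d : Dec P) → ¬ P → δ d ≡ 0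
  δ-no d ¬p = cong 𝟙 (dec-false d ¬p)

  δ-suc⁻ : ∀ {P : Set} (d : Dec P) {j} → δ d ≡ suc j → P
  δ-suc⁻ (yes p) _ = p

  δ-zero⁻ : ∀ {P : Set} (d : Dec P) → δ d ≡ 0 → ¬ P
  δ-zero⁻ (no ¬p) _ = ¬p

  ⌊⌋-true : ∀ {P : Set} (d : Dec P) → P → ⌊ d ⌋ ≡ true
  ⌊⌋-true d p = trans (isYes≗does d) (dec-true d p)

  ⌊⌋-false : ∀ {P : Set} (d : Dec P) → ¬ P → ⌊ d ⌋ ≡ false
  ⌊⌋-false d ¬p = trans (isYes≗does d) (dec-false d ¬p)

  ⌊⌋-true⁻ : ∀ {P : Set} (d : Dec P) → ⌊ d ⌋ ≡ true → P
  ⌊⌋-true⁻ (yes p) _ = p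

  module _ {A : Set} where
    ∑-cong : ∀ (L : List A) {f g : A → ℕ} → (∀ x → f x ≡ g x) → ∑ L f ≡ ∑ L g
    ∑-cong []      e = refl
    ∑-cong (x ∷ L) e = cong₂ _+_ (e x) (∑-cong L e)

    ∑-+ : ∀ (L : List A) (f g : A → ℕ) → ∑ L (λ x → f x + g x) ≡ ∑ L f + ∑ L g
    ∑-+ []      f g = refl
    ∑-+ (x ∷ L) f g rewrite ∑-+ L f g = interchange (f x) (g x) (∑ L f) (∑ L g)
      where
      interchange : ∀ a b c d → (a + b) + (c + d) ≡ (a + c) + (b + d)
      interchange = solve-∀

    ∑-*ˡ : ∀ (L : List A) k (f : A → ℕ) → ∑ L (λ x → k * f x) ≡ k * ∑ L f
    ∑-*ˡ []      k f = sym (*-zeroʳ k)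
    ∑-*ˡ (x ∷ L) k f rewrite ∑-*ˡ L k f = sym (*-distribˡ-+ k (f x) (∑ L f))

    ∑-*ʳ : ∀ (L : List A) k (f : A → ℕ) → ∑ L (λ x → f x * k) ≡ ∑ L f * k
    ∑-*ʳ L k f = trans (∑-cong L (λ x → *-comm (f x) k)) (trans (∑-*ˡ L k f) (*-comm k _))

    ∑-const : ∀ (L : List A) c → ∑ L (λ _ → c) ≡ length L * c
    ∑-const []      c = refl
    ∑-const (x ∷ L) c = cong (c +_) (∑-const L c)

    ∑-cong-∈ : ∀ (L : List A) {f g : A → ℕ} → (∀ {x} → x ∈ L → f x ≡ g x) → ∑ L f ≡ ∑ L g
    ∑-cong-∈ []      e = refl
    ∑-cong-∈ (x ∷ L) e = cong₂ _+_ (e (here refl)) (∑-cong-∈ L (λ m → e (there m)))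

    ∑-zero : ∀ (L : List A) (f : A → ℕ) → (∀ x → f x ≡ 0) → ∑ L f ≡ 0
    ∑-zero []      f e = refl
    ∑-zero (x ∷ L) f e rewrite e x = ∑-zero L f e

    ∑-zero⁻ : ∀ (L : List A) (f : A → ℕ) → ∑ L f ≡ 0 → ∀ {x} → x ∈ L → f x ≡ 0
    ∑-zero⁻ (y ∷ L) f e (here refl) = m+n≡0⇒m≡0 (f y) e
    ∑-zero⁻ (y ∷ L) f e (there p)   = ∑-zero⁻ L f (m+n≡0⇒n≡0 (f y) e) p

    ∑-suc⁻ : ∀ (L : List A) (f : A → ℕ) {k} → ∑ L f ≡ suc k → ∃ λ x → ∃ λ j → f x ≡ suc j
    ∑-suc⁻ []      f ()
    ∑-suc⁻ (x ∷ L) f e with f x in fx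
    ... | suc j = x , j , fx
    ... | zero  = ∑-suc⁻ L f e

    ∑-mono : ∀ (L : List A) {f g : A → ℕ} → (∀ x → f x ≤ g x) → ∑ L f ≤ ∑ L g
    ∑-mono []      e = z≤n
    ∑-mono (x ∷ L) e = +-mono-≤ (e x) (∑-mono L e)

    ∑-++ : ∀ (L M : List A) f → ∑ (L ++ M) f ≡ ∑ L f + ∑ M f
    ∑-++ []      M f = refl
    ∑-++ (x ∷ L) M f rewrite ∑-++ L M f = sym (+-assoc (f x) _ _)

    ∑-filter : ∀ (L : List A) (p : A → Bool) f → ∑ (filterᵇ p L) f ≡ ∑ L (λ x → 𝟙 (p x) * f x)
    ∑-filter []      p f = refl
    ∑-filter (x ∷ L) p f with p x
    ... | true  = cong₂ _+_ (sym (+-identityʳ (f x))) (∑-filter L p f)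
    ... | false = ∑-filter L p f

    length-filter : ∀ (L : List A) (p : A → Bool) → length (filterᵇ p L) ≡ ∑ L (λ x → 𝟙 (p x))
    length-filter []      p = refl
    length-filter (x ∷ L) p with p x
    ... | true  = cong suc (length-filter L p)
    ... | false = length-filter L p

    module _ (_≟_ : DecidableEquality A) where
      private
        sift-absent : ∀ (L : List A) t (h : A → ℕ) → All (t ≢_) L →
          ∑ L (λ x → δ (x ≟ t) * h x) ≡ 0
        sift-absent []      t h []         = refl
        sift-absent (x ∷ L) t h (t≢x ∷ ns) with x ≟ t
        ... | yes x≡t = ⊥-elim (t≢x (sym x≡t))
        ... | no _    = sift-absent L t h ns

        not-in : ∀ {x} {L : List A} → All (x ≢_) L → x ∈ L → ∀ {B : Set} → B
        not-in (x≢ ∷ _)  (here refl) = ⊥-elim (x≢ refl)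
        not-in (_ ∷ ns)  (there m)   = not-in ns m

      sift : ∀ (L : List A) t (h : A → ℕ) → AllPairs _≢_ L → t ∈ L →
        ∑ L (λ x → δ (x ≟ t) * h x) ≡ h t
      sift (x ∷ L) t h (x≢ ∷ u) (here refl) with x ≟ x
      ... | yes _ = trans (cong₂ _+_ (+-identityʳ (h x)) (sift-absent L x h x≢)) (+-identityʳ (h x))
      ... | no x≢x = ⊥-elim (x≢x refl)
      sift (x ∷ L) t h (x≢ ∷ u) (there m) with x ≟ t
      ... | yes refl = not-in x≢ m
      ... | no _     = sift L t h u m

  module _ {A B : Set} where
    ∑-swap : ∀ (L : List A) (M : List B) (h : A → B → ℕ) →
      ∑ L (λ x → ∑ M (h x)) ≡ ∑ M (λ y → ∑ L (λ x → h x y))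
    ∑-swap []      M h = sym (∑-zero M _ (λ _ → refl))
    ∑-swap (x ∷ L) M h = trans (cong (∑ M (h x) +_) (∑-swap L M h))
                               (sym (∑-+ M (h x) (λ y → ∑ L (λ x' → h x' y))))

    ∑-map : ∀ (L : List A) (g : A → B) f → ∑ (map g L) f ≡ ∑ L (λ x → f (g x))
    ∑-map []      g f = refl
    ∑-map (x ∷ L) g f = cong (f (g x) +_) (∑-map L g f)

    ∑-concatMap : ∀ (L : List A) (g : A → List B) f → ∑ (concatMap g L) f ≡ ∑ L (λ x → ∑ (g x) f)
    ∑-concatMap []      g f = refl
    ∑-concatMap (x ∷ L) g f = trans (∑-++ (g x) (concatMap g L) f) (cong (∑ (g x) f +_) (∑-concatMap L g f))

module Arithmetic where
  open import Data.Nat using (ℕ; zero; suc; _+_; _*_; _∸_; _^_; _<_; _≤_; _≤?_; z≤n; s≤s; >-nonZero)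
  open import Data.Nat.DivMod using (_/_; m*n/n≡m)
  open import Data.Nat.Divisibility using (_∣_; divides)
  open import Data.Nat.Properties
  open import Data.Nat.Tactic.RingSolver using (solve-∀)
  open import Relation.Binary.PropositionalEquality
  open import Relation.Nullary using (yes; no)
  open import Data.Empty using (⊥-elim)

  -- For even q > 0 write q = m + 1 and q² = 2K; the halved quantities of the
  -- statement become the products below (q³/2 = Kq, (q³ − q²)/2 = Km,
  -- q²(q² − 1)/2 = K·m(q + 1)).
  record Parameters (q : ℕ) : Set where
    field
      K m        : ℕ
      K≥1        : 1 ≤ K
      m≥1        : 1 ≤ m
      q≡1+m      : q ≡ suc m
      half-q³    : q ^ 3 / 2 ≡ K * q
      half-q³-q² : (q ^ 3 ∸ q ^ 2) / 2 ≡ K * m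
      half-size  : (q ^ 2 * (q ^ 2 ∸ 1)) / 2 ≡ K * (m * (q + 1))

  half : ∀ {x} y → x ≡ y * 2 → x / 2 ≡ y
  half y refl = m*n/n≡m y 2

  -- Polynomial identities behind the record fields, for q = 2(i + 1)
  -- (powers are written out: x ^ 3 unfolds to x * (x * (x * 1))).
  private
    cube-even : ∀ i → let q = (1 + i) * 2 in q * (q * (q * 1)) ≡ (1 + i) * (1 + i) * 2 * q * 2
    cube-even = solve-∀
    cube-split-even : ∀ i → let q = (1 + i) * 2 in
      q * (q * (q * 1)) ≡ (1 + i) * (1 + i) * 2 * (1 + i * 2) * 2 + q * (q * 1)
    cube-split-even = solve-∀
    square-even : ∀ i → let q = (1 + i) * 2 in q * (q * 1) ≡ 1 + (1 + i * 2) * (q + 1)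
    square-even = solve-∀
    size-even : ∀ i → let q = (1 + i) * 2 in
      q * (q * 1) * ((1 + i * 2) * (q + 1)) ≡ (1 + i) * (1 + i) * 2 * ((1 + i * 2) * (q + 1)) * 2
    size-even = solve-∀

  parameters : ∀ q → 0 < q → 2 ∣ q → Parameters q
  parameters .(suc j * 2) _ (divides (suc j) refl) = record
    { K = K ; m = m ; K≥1 = s≤s z≤n ; m≥1 = s≤s z≤n ; q≡1+m = refl
    ; half-q³    = half (K * q) (cube-even j)
    ; half-q³-q² = half (K * m) (trans (cong (_∸ q ^ 2) (cube-split-even j)) (m+n∸n≡m (K * m * 2) (q ^ 2)))
    ; half-size  = half (K * (m * (q + 1))) (trans (cong (q ^ 2 *_) (cong (_∸ 1) (square-even j))) (size-even j))
    }
    where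
    q m K : ℕ
    q = suc j * 2
    m = suc (j * 2)
    K = suc j * suc j * 2
  parameters .0 () (divides zero refl)

  private
    regroup : ∀ x y m → (x + y) * suc m ≡ (x * suc m + y * m) + y
    regroup = solve-∀
    grow : ∀ m → m * suc m + m ≡ m * (suc m + 1)
    grow = solve-∀
    square-succ : ∀ m → suc m * suc m ≡ m * (suc m + 1) + 1
    square-succ = solve-∀
    cube-succ : ∀ m → (1 + m) * (m * ((1 + m) + 1) + 1) ≡ (1 + m) * ((1 + m) * ((1 + m) * 1))
    cube-succ = solve-∀
    factor-succ : ∀ m X → (1 + m) * X + (1 + m) ≡ (1 + m) * (X + 1)
    factor-succ = solve-∀

  -- On a line through a red point, x points of degree
  -- Kq and y black points (degree Km) among the q = m + 1 others, with total
  -- degree K·m(q + 1), force y = 1 (after cancelling K).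
  unique-black : ∀ x y m → 1 ≤ m → x + y ≤ suc m → x * suc m + y * m ≡ m * (suc m + 1) → y ≡ 1
  unique-black x y m m≥1 x+y≤q e with x + y ≤? m
  ... | yes x+y≤m = ⊥-elim (<⇒≢ too-small (trans (regroup x y m) (cong (_+ y) e)))
    where
    open ≤-Reasoning
    too-small : (x + y) * suc m < m * (suc m + 1) + y
    too-small = begin-strict
      (x + y) * suc m     ≤⟨ *-monoˡ-≤ (suc m) x+y≤m ⟩
      m * suc m           <⟨ m<m+n (m * suc m) m≥1 ⟩
      m * suc m + m       ≡⟨ grow m ⟩
      m * (suc m + 1)     ≤⟨ m≤m+n _ y ⟩
      m * (suc m + 1) + y ∎
  ... | no x+y≰m = +-cancelˡ-≡ (m * (suc m + 1)) y 1 (begin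
      m * (suc m + 1) + y          ≡⟨ cong (_+ y) e ⟨
      (x * suc m + y * m) + y      ≡⟨ regroup x y m ⟨
      (x + y) * suc m              ≡⟨ cong (_* suc m) x+y≡q ⟩
      suc m * suc m                ≡⟨ square-succ m ⟩
      m * (suc m + 1) + 1          ∎)
    where
    open ≡-Reasoning
    x+y≡q : x + y ≡ suc m
    x+y≡q = ≤-antisym x+y≤q (≰⇒> x+y≰m)

  solve-count : ∀ m X N → 1 ≤ m → suc m ^ 3 ≡ suc m * X + suc m → X ≡ m * N → N ≡ suc m + 1
  solve-count m X N m≥1 e X≡mN =
    *-cancelˡ-≡ N (suc m + 1) m {{>-nonZero m≥1}} (trans (sym X≡mN) X≡m[q+1])
    where
    -- q(q² − 1 + 1) = q³ = q(X + 1)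
    X≡m[q+1] : X ≡ m * (suc m + 1)
    X≡m[q+1] = sym (+-cancelʳ-≡ 1 _ _ (*-cancelˡ-≡ _ _ (suc m) (trans (cube-succ m) (trans e (factor-succ m X)))))

module Linear (F : FiniteField) where
  open FiniteField F
  open PG4 F using (dot; isZero)
  open ListSums using (⌊⌋-true; ⌊⌋-false; ⌊⌋-true⁻)
  open import Data.Bool using (true; false)
  open import Data.Vec using (Vec; []; _∷_; zipWith; replicate)
  import Data.Vec as V
  open import Data.Vec.Properties using (∷-injective)
  open import Data.Product using (_,_)
  open import Relation.Binary.PropositionalEquality
  open import Relation.Nullary using (yes; no)
  open import Algebra.Bundles using (CommutativeRing)
  open import Algebra.Structures using (IsCommutativeRing)
  import Algebra.Properties.Group as GroupProperties
  import Algebra.Properties.Ring as RingProperties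
  import Algebra.Properties.CommutativeSemigroup as CommutativeSemigroupProperties
  open ≡-Reasoning

  module R = IsCommutativeRing isCommutativeRing

  commutativeRing : CommutativeRing _ _
  commutativeRing = record { isCommutativeRing = isCommutativeRing }

  module +G  = GroupProperties (CommutativeRing.+-group commutativeRing)
  module +CS = CommutativeSemigroupProperties (CommutativeRing.+-commutativeSemigroup commutativeRing)
  module *CS = CommutativeSemigroupProperties (CommutativeRing.*-commutativeSemigroup commutativeRing)
  module RP  = RingProperties (CommutativeRing.ring commutativeRing)

  1≢0 : 1# ≢ 0#
  1≢0 e = 0≢1 (sym e)

  no-zero-divisors : ∀ c x → c ≢ 0# → c * x ≡ 0# → x ≡ 0#
  no-zero-divisors c x c≢0 cx≡0 with inverse c c≢0
  ... | y , cy≡1 = begin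
    x           ≡⟨ R.*-identityˡ x ⟨
    1# * x      ≡⟨ cong (_* x) (trans (sym cy≡1) (R.*-comm c y)) ⟩
    (y * c) * x ≡⟨ R.*-assoc y c x ⟩
    y * (c * x) ≡⟨ cong (y *_) cx≡0 ⟩
    y * 0#      ≡⟨ R.zeroʳ y ⟩
    0#          ∎

  *-nonzero : ∀ a b → a ≢ 0# → b ≢ 0# → a * b ≢ 0#
  *-nonzero a b a≢0 b≢0 ab≡0 = b≢0 (no-zero-divisors a b a≢0 ab≡0)

  *-cancelˡ : ∀ c x y → c ≢ 0# → c * x ≡ c * y → x ≡ y
  *-cancelˡ c x y c≢0 e = +G.x∙y⁻¹≈ε⇒x≈y x y (no-zero-divisors c _ c≢0 (begin
    c * (x + - y)     ≡⟨ R.distribˡ c x (- y) ⟩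
    c * x + c * - y   ≡⟨ cong (c * x +_) (RP.-‿distribʳ-* c y) ⟨
    c * x + - (c * y) ≡⟨ cong (λ z → z + - (c * y)) e ⟩
    c * y + - (c * y) ≡⟨ R.-‿inverseʳ (c * y) ⟩
    0#                ∎))

  isZero-true : ∀ x → x ≡ 0# → isZero x ≡ true
  isZero-true x = ⌊⌋-true (x ≟ 0#)

  isZero-false : ∀ x → x ≢ 0# → isZero x ≡ false
  isZero-false x = ⌊⌋-false (x ≟ 0#)

  isZero-true⁻ : ∀ x → isZero x ≡ true → x ≡ 0#
  isZero-true⁻ x = ⌊⌋-true⁻ (x ≟ 0#)

  isZero-* : ∀ c d → c ≢ 0# → isZero (c * d) ≡ isZero d
  isZero-* c d c≢0 with d ≟ 0#
  ... | yes refl = isZero-true (c * 0#) (R.zeroʳ c)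
  ... | no d≢0   = isZero-false (c * d) (*-nonzero c d c≢0 d≢0)

  infixl 6 _+V_
  infixr 7 _·V_

  _+V_ : ∀ {n} → Vec Carrier n → Vec Carrier n → Vec Carrier n
  _+V_ = zipWith _+_

  _·V_ : ∀ {n} → Carrier → Vec Carrier n → Vec Carrier n
  c ·V v = V.map (c *_) v

  0V : ∀ n → Vec Carrier n
  0V n = replicate n 0#

  ·V-assoc : ∀ {n} c d (v : Vec Carrier n) → c ·V d ·V v ≡ (c * d) ·V v
  ·V-assoc c d []      = refl
  ·V-assoc c d (x ∷ v) = cong₂ _∷_ (sym (R.*-assoc c d x)) (·V-assoc c d v)

  ·V-identity : ∀ {n} (v : Vec Carrier n) → 1# ·V v ≡ v
  ·V-identity []      = refl
  ·V-identity (x ∷ v) = cong₂ _∷_ (R.*-identityˡ x) (·V-identity v)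

  ·V-zero : ∀ {n} (v : Vec Carrier n) → 0# ·V v ≡ 0V n
  ·V-zero []      = refl
  ·V-zero (x ∷ v) = cong₂ _∷_ (R.zeroˡ x) (·V-zero v)

  ·V-distrib : ∀ {n} a b (v : Vec Carrier n) → a ·V v +V b ·V v ≡ (a + b) ·V v
  ·V-distrib a b []      = refl
  ·V-distrib a b (x ∷ v) = cong₂ _∷_ (sym (R.distribʳ x a b)) (·V-distrib a b v)

  ·V-cancel : ∀ {n} c (u v : Vec Carrier n) → c ≢ 0# → c ·V u ≡ c ·V v → u ≡ v
  ·V-cancel c []      []      c≢0 e = refl
  ·V-cancel c (x ∷ u) (y ∷ v) c≢0 e with ∷-injective e
  ... | ex , eu = cong₂ _∷_ (*-cancelˡ c x y c≢0 ex) (·V-cancel c u v c≢0 eu)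

  +V-solve : ∀ {n} (v w : Vec Carrier n) l → v +V l ·V w ≡ 0V n → v ≡ (- l) ·V w
  +V-solve []      []      l e = refl
  +V-solve (x ∷ v) (r ∷ w) l e with ∷-injective e
  ... | ex , ev = cong₂ _∷_ x≡-lr (+V-solve v w l ev)
    where
    x≡-lr : x ≡ (- l) * r
    x≡-lr = begin
      x                    ≡⟨ +G.//-rightDividesʳ (l * r) x ⟨
      (x + l * r) + - (l * r) ≡⟨ cong (_+ - (l * r)) ex ⟩
      0# + - (l * r)       ≡⟨ R.+-identityˡ _ ⟩
      - (l * r)            ≡⟨ RP.-‿distribˡ-* l r ⟩
      (- l) * r            ∎

  dot-+ : ∀ {n} (s u v : Vec Carrier n) → dot s (u +V v) ≡ dot s u + dot s v
  dot-+ []       []       []       = sym (R.+-identityˡ 0#)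
  dot-+ (s ∷ ss) (u ∷ us) (v ∷ vs) = begin
    s * (u + v) + dot ss (us +V vs)           ≡⟨ cong₂ _+_ (R.distribˡ s u v) (dot-+ ss us vs) ⟩
    (s * u + s * v) + (dot ss us + dot ss vs) ≡⟨ +CS.interchange (s * u) (s * v) (dot ss us) (dot ss vs) ⟩
    (s * u + dot ss us) + (s * v + dot ss vs) ∎

  dot-· : ∀ {n} (s : Vec Carrier n) c v → dot s (c ·V v) ≡ c * dot s v
  dot-· []       c []       = sym (R.zeroʳ c)
  dot-· (s ∷ ss) c (v ∷ vs) = begin
    s * (c * v) + dot ss (c ·V vs)   ≡⟨ cong₂ _+_ (*CS.x∙yz≈y∙xz s c v) (dot-· ss c vs) ⟩
    c * (s * v) + c * dot ss vs      ≡⟨ R.distribˡ c (s * v) (dot ss vs) ⟨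
    c * (s * v + dot ss vs)          ∎

  dot-0ʳ : ∀ {n} (s : Vec Carrier n) → dot s (0V n) ≡ 0#
  dot-0ʳ []       = refl
  dot-0ʳ (s ∷ ss) = trans (cong₂ _+_ (R.zeroʳ s) (dot-0ʳ ss)) (R.+-identityʳ 0#)

  dot-0ˡ : ∀ {n} (w : Vec Carrier n) → dot (0V n) w ≡ 0#
  dot-0ˡ []      = refl
  dot-0ˡ (x ∷ w) = trans (cong₂ _+_ (R.zeroˡ x) (dot-0ˡ w)) (R.+-identityʳ 0#)

module Normalisation (F : FiniteField) where
  open FiniteField F
  open PG4 F using (dot; normalized)
  open Linear F
  open ListSums using (⌊⌋-true; ⌊⌋-true⁻)
  open import Data.Nat using (zero; suc)
  open import Data.Bool using (true; false)
  open import Data.Vec using (Vec; []; _∷_)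
  open import Data.Vec.Properties using (∷-injective)
  open import Data.Product using (∃; _×_; _,_; proj₁; proj₂)
  open import Relation.Binary.PropositionalEquality
  open import Relation.Nullary using (yes; no)
  open import Data.Empty using (⊥-elim)

  normalized-0∷ : ∀ {n} (xs : Vec Carrier n) → normalized (0# ∷ xs) ≡ normalized xs
  normalized-0∷ xs rewrite isZero-true 0# refl = refl

  normalized-1∷ : ∀ {n} (xs : Vec Carrier n) → normalized (1# ∷ xs) ≡ true
  normalized-1∷ xs rewrite isZero-false 1# 1≢0 = ⌊⌋-true (1# ≟ 1#) refl

  normalized-0V : ∀ n → normalized (0V n) ≡ false
  normalized-0V zero    = refl
  normalized-0V (suc n) = trans (normalized-0∷ (0V n)) (normalized-0V n)

  normalized⇒nonzero : ∀ {n} (P : Vec Carrier n) → normalized P ≡ true → P ≢ 0V n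
  normalized⇒nonzero {n} P e refl with trans (sym e) (normalized-0V n)
  ... | ()

  normalise : ∀ {n} (v : Vec Carrier n) → v ≢ 0V n →
    ∃ λ c → ∃ λ P → c ≢ 0# × normalized P ≡ true × v ≡ c ·V P
  normalise []      v≢0 = ⊥-elim (v≢0 refl)
  normalise (x ∷ v) v≢0 with x ≟ 0#
  ... | yes refl with normalise v (λ e → v≢0 (cong (0# ∷_) e))
  ...   | c , P , c≢0 , nP , v≡cP =
          c , 0# ∷ P , c≢0 , trans (normalized-0∷ P) nP , cong₂ _∷_ (sym (R.zeroʳ c)) v≡cP
  normalise (x ∷ v) v≢0 | no x≢0 with inverse x x≢0
  ... | y , xy≡1 = x , 1# ∷ y ·V v , x≢0 , normalized-1∷ (y ·V v) ,
        cong₂ _∷_ (sym (R.*-identityʳ x)) (sym (begin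
          x ·V y ·V v   ≡⟨ ·V-assoc x y v ⟩
          (x * y) ·V v  ≡⟨ cong (_·V v) xy≡1 ⟩
          1# ·V v       ≡⟨ ·V-identity v ⟩
          v             ∎))
    where open ≡-Reasoning

  normalise-unique : ∀ {n} c c' (P P' : Vec Carrier n) → c ≢ 0# → c' ≢ 0# →
    normalized P ≡ true → normalized P' ≡ true → c ·V P ≡ c' ·V P' → c ≡ c' × P ≡ P'
  -- (Splitting on p ≟ 0# and p' ≟ 0# also unfolds nP and nP'.)
  normalise-unique c c' (p ∷ P) (p' ∷ P') c≢0 c'≢0 nP nP' e with ∷-injective e | p ≟ 0# | p' ≟ 0#
  ... | _ , eP | yes refl | yes refl
      with normalise-unique c c' P P' c≢0 c'≢0 nP nP' eP
  ...   | c≡c' , P≡P' = c≡c' , cong (0# ∷_) P≡P'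
  normalise-unique c c' (p ∷ P) (p' ∷ P') c≢0 c'≢0 nP nP' e | ep , _ | yes refl | no p'≢0 =
    ⊥-elim (p'≢0 (no-zero-divisors c' p' c'≢0 (trans (sym ep) (R.zeroʳ c))))
  normalise-unique c c' (p ∷ P) (p' ∷ P') c≢0 c'≢0 nP nP' e | ep , _ | no p≢0 | yes refl =
    ⊥-elim (p≢0 (no-zero-divisors c p c≢0 (trans ep (R.zeroʳ c'))))
  normalise-unique c c' (p ∷ P) (p' ∷ P') c≢0 c'≢0 nP nP' e | ep , eP | no p≢0 | no p'≢0
      with ⌊⌋-true⁻ (p ≟ 1#) nP | ⌊⌋-true⁻ (p' ≟ 1#) nP'
  ... | refl | refl = c≡c' , cong (1# ∷_) (·V-cancel c P P' c≢0 (trans eP (cong (_·V P') (sym c≡c'))))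
    where
    c≡c' : c ≡ c'
    c≡c' = trans (sym (R.*-identityʳ c)) (trans ep (R.*-identityʳ c'))

  ·V-injectiveˡ : ∀ {n} (R : Vec Carrier n) → normalized R ≡ true → ∀ μ μ' → μ ·V R ≡ μ' ·V R → μ ≡ μ'
  ·V-injectiveˡ (r ∷ R) nR μ μ' e with r ≟ 0#  -- also unfolds nR
  ... | yes refl = ·V-injectiveˡ R nR μ μ' (proj₂ (∷-injective e))
  ... | no r≢0 with ⌊⌋-true⁻ (r ≟ 1#) nR
  ...   | refl = trans (sym (R.*-identityʳ μ)) (trans (proj₁ (∷-injective e)) (R.*-identityʳ μ'))

  separate : ∀ {n} (c d : Vec Carrier n) → c ≢ d → ∃ λ w → dot c w + - dot d w ≡ 1#
  separate []      []      c≢d = ⊥-elim (c≢d refl)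
  separate (x ∷ c) (y ∷ d) c≢d with x ≟ y
  ... | yes refl with separate c d (λ e → c≢d (cong (x ∷_) e))
  ...   | w , e = 0# ∷ w , trans (cong₂ (λ a b → a + - b) (drop-zero-term x (dot c w)) (drop-zero-term x (dot d w))) e
    where
    drop-zero-term : ∀ x a → x * 0# + a ≡ a
    drop-zero-term x a = trans (cong (_+ a) (R.zeroʳ x)) (R.+-identityˡ a)
  separate (x ∷ c) (y ∷ d) c≢d | no x≢y with inverse (x + - y) (λ e → x≢y (+G.x∙y⁻¹≈ε⇒x≈y x y e))
  ... | z , e = z ∷ 0V _ , (begin
      (x * z + dot c (0V _)) + - (y * z + dot d (0V _))
        ≡⟨ cong₂ (λ a b → (x * z + a) + - (y * z + b)) (dot-0ʳ c) (dot-0ʳ d) ⟩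
      (x * z + 0#) + - (y * z + 0#) ≡⟨ cong₂ (λ a b → a + - b) (R.+-identityʳ _) (R.+-identityʳ _) ⟩
      x * z + - (y * z)  ≡⟨ cong (x * z +_) (RP.-‿distribˡ-* y z) ⟩
      x * z + (- y) * z  ≡⟨ R.distribʳ z x (- y) ⟨
      (x + - y) * z      ≡⟨ e ⟩
      1#                 ∎)
    where open ≡-Reasoning

  dual-vector : ∀ {n} (a b : Vec Carrier n) → normalized a ≡ true → normalized b ≡ true → a ≢ b →
    ∃ λ u → dot a u ≡ 1# × dot b u ≡ 0#
  dual-vector (x ∷ a) (y ∷ b) na nb a≢b with x ≟ 0# | y ≟ 0#  -- also unfolds na and nb
  ... | yes refl | yes refl with dual-vector a b na nb (λ e → a≢b (cong (0# ∷_) e))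
  ...   | u , au≡1 , bu≡0 = 0# ∷ u , trans (drop-zero-term (dot a u)) au≡1 , trans (drop-zero-term (dot b u)) bu≡0
    where
    drop-zero-term : ∀ a → 0# * 0# + a ≡ a
    drop-zero-term a = trans (cong (_+ a) (R.zeroʳ 0#)) (R.+-identityˡ a)
  dual-vector (x ∷ a) (y ∷ b) na nb a≢b | yes refl | no y≢0
      with ⌊⌋-true⁻ (y ≟ 1#) nb | separate a (0V _) (normalized⇒nonzero a na)
  ... | refl | w , e = - dot b w ∷ w , a-side , b-side
    where
    aw≡1 : dot a w ≡ 1#
    aw≡1 = trans (sym (trans (cong (λ z → dot a w + - z) (dot-0ˡ w))
                   (trans (cong (dot a w +_) +G.ε⁻¹≈ε) (R.+-identityʳ _)))) e
    a-side : 0# * - dot b w + dot a w ≡ 1#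
    a-side = trans (cong (_+ dot a w) (R.zeroˡ _)) (trans (R.+-identityˡ _) aw≡1)
    b-side : 1# * - dot b w + dot b w ≡ 0#
    b-side = trans (cong (_+ dot b w) (R.*-identityˡ _)) (R.-‿inverseˡ (dot b w))
  dual-vector (x ∷ a) (y ∷ b) na nb a≢b | no x≢0 | yes refl with ⌊⌋-true⁻ (x ≟ 1#) na
  ... | refl = 1# ∷ 0V _ , trans (cong₂ _+_ (R.*-identityˡ 1#) (dot-0ʳ a)) (R.+-identityʳ 1#) ,
                           trans (cong₂ _+_ (R.zeroˡ 1#) (dot-0ʳ b)) (R.+-identityʳ 0#)
  dual-vector (x ∷ a) (y ∷ b) na nb a≢b | no x≢0 | no y≢0 with ⌊⌋-true⁻ (x ≟ 1#) na | ⌊⌋-true⁻ (y ≟ 1#) nb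
  ... | refl | refl with separate a b (λ e → a≢b (cong (1# ∷_) e))
  ...   | w , e = - dot b w ∷ w , a-side , b-side
    where
    a-side : 1# * - dot b w + dot a w ≡ 1#
    a-side = trans (cong (_+ dot a w) (R.*-identityˡ _)) (trans (R.+-comm _ _) e)
    b-side : 1# * - dot b w + dot b w ≡ 0#
    b-side = trans (cong (_+ dot b w) (R.*-identityˡ _)) (R.-‿inverseˡ (dot b w))

module FieldSums (F : FiniteField) where
  open FiniteField F
  open PG4 F using (q; dot; allVecs; normalized; isZero)
  open Linear F
  open Normalisation F using (dual-vector)
  open ListSums
  open import Data.Nat as N using (ℕ; zero; suc)
  import Data.Nat.Properties as NP
  open import Data.Bool using (true; not)
  open import Data.List using (map)
  open import Data.List.Membership.Propositional using (_∈_)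
  open import Data.List.Membership.Propositional.Properties using (∈-map⁺; ∈-concatMap⁺)
  import Data.List.Relation.Unary.Any as Any
  open import Data.List.Relation.Unary.Any using (here)
  open import Data.Vec using (Vec; []; _∷_)
  import Data.Vec.Properties as VP
  open import Data.Product using (_,_)
  open import Relation.Binary.PropositionalEquality
  open import Relation.Nullary using (Dec; yes; no; does)
  open import Relation.Nullary.Decidable using (⌊_⌋)
  open ≡-Reasoning

  ∑F : (Carrier → ℕ) → ℕ
  ∑F = ∑ elems

  ∑V : ∀ n → (Vec Carrier n → ℕ) → ℕ
  ∑V n = ∑ (allVecs n)

  infix 4 _≟V_
  _≟V_ : ∀ {n} (u v : Vec Carrier n) → Dec (u ≡ v)
  _≟V_ = VP.≡-dec _≟_

  allVecs-complete : ∀ n (v : Vec Carrier n) → v ∈ allVecs n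
  allVecs-complete zero    []      = here refl
  allVecs-complete (suc n) (x ∷ v) = ∈-concatMap⁺ (λ z → map (z ∷_) (allVecs n))
    (Any.map (λ { refl → ∈-map⁺ (x ∷_) (allVecs-complete n v) }) (complete x))

  ∑V-suc : ∀ n g → ∑V (suc n) g ≡ ∑F (λ x → ∑V n (λ v → g (x ∷ v)))
  ∑V-suc n g = trans (∑-concatMap elems (λ x → map (x ∷_) (allVecs n)) g)
                     (∑-cong elems (λ x → ∑-map (allVecs n) (x ∷_) g))

  ∑F-const : ∀ c → ∑F (λ _ → c) ≡ q N.* c
  ∑F-const = ∑-const elems

  ∑F-one : ∑F (λ _ → 1) ≡ q
  ∑F-one = trans (∑F-const 1) (NP.*-identityʳ q)

  ∑V-const : ∀ n c → ∑V n (λ _ → c) ≡ q N.^ n N.* c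
  ∑V-const zero    c = refl
  ∑V-const (suc n) c = begin
    ∑V (suc n) (λ _ → c)          ≡⟨ ∑V-suc n _ ⟩
    ∑F (λ _ → ∑V n (λ _ → c))     ≡⟨ ∑F-const _ ⟩
    q N.* ∑V n (λ _ → c)          ≡⟨ cong (q N.*_) (∑V-const n c) ⟩
    q N.* (q N.^ n N.* c)         ≡⟨ NP.*-assoc q _ c ⟨
    q N.^ suc n N.* c             ∎

  ∑F-sift : ∀ t (h : Carrier → ℕ) → ∑F (λ x → δ (x ≟ t) N.* h x) ≡ h t
  ∑F-sift t h = sift _≟_ elems t h unique (complete t)

  ∑F-count-one : ∀ t → ∑F (λ x → δ (x ≟ t)) ≡ 1
  ∑F-count-one t = trans (∑-cong elems (λ x → sym (NP.*-identityʳ (δ (x ≟ t))))) (∑F-sift t (λ _ → 1))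

  private
    δ-∷ : ∀ {n} x t (v u : Vec Carrier n) → δ ((x ∷ v) ≟V (t ∷ u)) ≡ δ (x ≟ t) N.* δ (v ≟V u)
    δ-∷ x t v u = 𝟙-∧ (does (x ≟ t)) (does (v ≟V u))

  ∑V-sift : ∀ n (t : Vec Carrier n) (h : Vec Carrier n → ℕ) → ∑V n (λ v → δ (v ≟V t) N.* h v) ≡ h t
  ∑V-sift zero    []      h = trans (NP.+-identityʳ (h [] N.+ 0)) (NP.+-identityʳ (h []))
  ∑V-sift (suc n) (t ∷ u) h = begin
    ∑V (suc n) (λ v → δ (v ≟V (t ∷ u)) N.* h v)
      ≡⟨ ∑V-suc n _ ⟩
    ∑F (λ x → ∑V n (λ v → δ ((x ∷ v) ≟V (t ∷ u)) N.* h (x ∷ v)))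
      ≡⟨ ∑-cong elems (λ x → ∑-cong (allVecs n) (λ v →
           trans (cong (N._* h (x ∷ v)) (δ-∷ x t v u)) (NP.*-assoc (δ (x ≟ t)) _ _))) ⟩
    ∑F (λ x → ∑V n (λ v → δ (x ≟ t) N.* (δ (v ≟V u) N.* h (x ∷ v))))
      ≡⟨ ∑-cong elems (λ x → ∑-*ˡ (allVecs n) (δ (x ≟ t)) _) ⟩
    ∑F (λ x → δ (x ≟ t) N.* ∑V n (λ v → δ (v ≟V u) N.* h (x ∷ v)))
      ≡⟨ ∑-cong elems (λ x → cong (δ (x ≟ t) N.*_) (∑V-sift n u (λ v → h (x ∷ v)))) ⟩
    ∑F (λ x → δ (x ≟ t) N.* h (x ∷ u))
      ≡⟨ ∑F-sift t (λ x → h (x ∷ u)) ⟩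
    h (t ∷ u) ∎

  -- Translation x ↦ x + u permutes F.
  ∑F-translate : ∀ u g → ∑F (λ x → g (x + u)) ≡ ∑F g
  ∑F-translate u g = begin
    ∑F (λ x → g (x + u))                       ≡⟨ ∑-cong elems (λ x → sym (∑F-sift (x + u) g)) ⟩
    ∑F (λ x → ∑F (λ y → δ (y ≟ (x + u)) N.* g y)) ≡⟨ ∑-swap elems elems _ ⟩
    ∑F (λ y → ∑F (λ x → δ (y ≟ (x + u)) N.* g y)) ≡⟨ ∑-cong elems (λ y → ∑-*ʳ elems (g y) _) ⟩
    ∑F (λ y → ∑F (λ x → δ (y ≟ (x + u))) N.* g y) ≡⟨ ∑-cong elems (λ y → cong (N._* g y) (one-preimage y)) ⟩
    ∑F (λ y → 1 N.* g y)                        ≡⟨ ∑-cong elems (λ y → NP.*-identityˡ (g y)) ⟩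
    ∑F g                                        ∎
    where
    one-preimage : ∀ y → ∑F (λ x → δ (y ≟ (x + u))) ≡ 1
    one-preimage y = trans (∑-cong elems (λ x → δ-iff (to x) (from x) (y ≟ (x + u)) (x ≟ (y + - u))))
                           (∑F-count-one (y + - u))
      where
      to : ∀ x → y ≡ x + u → x ≡ y + - u
      to x e = +G.x≈z//y x u y (sym e)
      from : ∀ x → x ≡ y + - u → y ≡ x + u
      from x e = trans (sym (+G.//-rightDividesˡ u y)) (cong (_+ u) (sym e))

  ∑V-translate : ∀ n (u : Vec Carrier n) g → ∑V n (λ v → g (v +V u)) ≡ ∑V n g
  ∑V-translate zero    []       g = refl
  ∑V-translate (suc n) (u ∷ us) g = begin
    ∑V (suc n) (λ v → g (v +V (u ∷ us)))         ≡⟨ ∑V-suc n _ ⟩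
    ∑F (λ x → ∑V n (λ v → g ((x + u) ∷ (v +V us))))
      ≡⟨ ∑-cong elems (λ x → ∑V-translate n us (λ w → g ((x + u) ∷ w))) ⟩
    ∑F (λ x → ∑V n (λ v → g ((x + u) ∷ v)))      ≡⟨ ∑F-translate u (λ y → ∑V n (λ v → g (y ∷ v))) ⟩
    ∑F (λ y → ∑V n (λ v → g (y ∷ v)))            ≡⟨ ∑V-suc n g ⟨
    ∑V (suc n) g                                 ∎

  nonzero : Carrier → ℕ
  nonzero c = 𝟙 (not (isZero c))

  count-nonzero : ∑F nonzero N.+ 1 ≡ q
  count-nonzero = begin
    ∑F nonzero N.+ 1                                  ≡⟨ cong (∑F nonzero N.+_) (∑F-count-one 0#) ⟨
    ∑F nonzero N.+ ∑F (λ c → δ (c ≟ 0#))              ≡⟨ ∑-+ elems _ _ ⟨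
    ∑F (λ c → nonzero c N.+ δ (c ≟ 0#))               ≡⟨ ∑-cong elems (λ c → partition (c ≟ 0#)) ⟩
    ∑F (λ _ → 1)                                      ≡⟨ ∑F-one ⟩
    q                                                 ∎
    where
    partition : ∀ {c} (d : Dec (c ≡ 0#)) → 𝟙 (not ⌊ d ⌋) N.+ δ d ≡ 1
    partition (yes _) = refl
    partition (no _)  = refl

  count-root : ∀ t c → c ≢ 0# → ∑F (λ l → δ ((t + l * c) ≟ 0#)) ≡ 1
  count-root t c c≢0 with inverse c c≢0
  ... | y , cy≡1 = trans (∑-cong elems (λ l → δ-iff (to l) (from l) ((t + l * c) ≟ 0#) (l ≟ ((- t) * y))))
                         (∑F-count-one ((- t) * y))
    where
    lc≡-t⇒ : ∀ l → l * c ≡ - t → l ≡ (- t) * y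
    lc≡-t⇒ l e = begin
      l            ≡⟨ R.*-identityʳ l ⟨
      l * 1#       ≡⟨ cong (l *_) cy≡1 ⟨
      l * (c * y)  ≡⟨ R.*-assoc l c y ⟨
      (l * c) * y  ≡⟨ cong (_* y) e ⟩
      (- t) * y    ∎
    to : ∀ l → t + l * c ≡ 0# → l ≡ (- t) * y
    to l e = lc≡-t⇒ l (trans (+G.x≈z//y (l * c) t 0# (trans (R.+-comm _ t) e)) (R.+-identityˡ (- t)))
    from : ∀ l → l ≡ (- t) * y → t + l * c ≡ 0#
    from l e = trans (cong (t +_) lc≡-t) (R.-‿inverseʳ t)
      where
      lc≡-t : l * c ≡ - t
      lc≡-t = begin
        l * c           ≡⟨ cong (_* c) e ⟩
        (- t) * y * c   ≡⟨ R.*-assoc (- t) y c ⟩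
        (- t) * (y * c) ≡⟨ cong ((- t) *_) (trans (R.*-comm y c) cy≡1) ⟩
        (- t) * 1#      ≡⟨ R.*-identityʳ (- t) ⟩
        - t             ∎

  commonZeros : ∀ {n} → Vec Carrier n → Vec Carrier n → ℕ
  commonZeros {n} a b = ∑V n (λ v → δ (dot a v ≟ 0#) N.* δ (dot b v ≟ 0#))

  -- Given vectors u₁, u₂ dual to a, b, translation by t₁u₁ + t₂u₂ maps the
  -- common zeros of a, b onto the fibre {v | a·v = t₁, b·v = t₂}.
  fibre-size : ∀ {n} (a b u₁ u₂ : Vec Carrier n) →
    dot a u₁ ≡ 1# → dot b u₁ ≡ 0# → dot a u₂ ≡ 0# → dot b u₂ ≡ 1# →
    ∀ t₁ t₂ → ∑V n (λ v → δ (t₁ ≟ dot a v) N.* δ (t₂ ≟ dot b v)) ≡ commonZeros a b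
  fibre-size {n} a b u₁ u₂ au₁ bu₁ au₂ bu₂ t₁ t₂ = begin
    ∑V n (λ v → δ (t₁ ≟ dot a v) N.* δ (t₂ ≟ dot b v))
      ≡⟨ ∑V-translate n u _ ⟨
    ∑V n (λ v → δ (t₁ ≟ dot a (v +V u)) N.* δ (t₂ ≟ dot b (v +V u)))
      ≡⟨ ∑-cong (allVecs n) (λ v → cong₂ N._*_
           (trans (cong (λ z → δ (t₁ ≟ z)) (shift-a v)) (shift-δ t₁ (dot a v)))
           (trans (cong (λ z → δ (t₂ ≟ z)) (shift-b v)) (shift-δ t₂ (dot b v)))) ⟩
    commonZeros a b ∎
    where
    u : Vec Carrier n
    u = t₁ ·V u₁ +V t₂ ·V u₂
    dot-u : ∀ s x y → dot s u₁ ≡ x → dot s u₂ ≡ y → dot s u ≡ t₁ * x + t₂ * y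
    dot-u s x y e₁ e₂ = trans (dot-+ s _ _) (cong₂ _+_ (trans (dot-· s t₁ u₁) (cong (t₁ *_) e₁))
                                                       (trans (dot-· s t₂ u₂) (cong (t₂ *_) e₂)))
    shift-a : ∀ v → dot a (v +V u) ≡ dot a v + t₁
    shift-a v = trans (dot-+ a v u) (cong (dot a v +_) (trans (dot-u a 1# 0# au₁ au₂)
                  (trans (cong₂ _+_ (R.*-identityʳ t₁) (R.zeroʳ t₂)) (R.+-identityʳ t₁))))
    shift-b : ∀ v → dot b (v +V u) ≡ dot b v + t₂
    shift-b v = trans (dot-+ b v u) (cong (dot b v +_) (trans (dot-u b 0# 1# bu₁ bu₂)
                  (trans (cong₂ _+_ (R.zeroʳ t₁) (R.*-identityʳ t₂)) (R.+-identityˡ t₂))))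
    shift-δ : ∀ t d → δ (t ≟ (d + t)) ≡ δ (d ≟ 0#)
    shift-δ t d = δ-iff to from (t ≟ (d + t)) (d ≟ 0#)
      where
      to : t ≡ d + t → d ≡ 0#
      to e = trans (+G.x≈z//y d t (d + t) refl) (trans (cong (_+ - t) (sym e)) (R.-‿inverseʳ t))
      from : d ≡ 0# → t ≡ d + t
      from e = sym (trans (cong (_+ t) e) (R.+-identityˡ t))

  -- Two distinct normalised linear forms on Fⁿ have q^(n−2) common zeros:
  -- the q² fibres of v ↦ (a·v, b·v) all have the size of the zero fibre.
  count-commonZeros : ∀ {n} (a b : Vec Carrier n) → normalized a ≡ true → normalized b ≡ true → a ≢ b →
    q N.^ n ≡ q N.* (q N.* commonZeros a b)
  count-commonZeros {n} a b na nb a≢b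
    with dual-vector a b na nb a≢b | dual-vector b a nb na (λ e → a≢b (sym e))
  ... | u₁ , au₁ , bu₁ | u₂ , bu₂ , au₂ = begin
    q N.^ n                                               ≡⟨ NP.*-identityʳ _ ⟨
    q N.^ n N.* 1                                         ≡⟨ ∑V-const n 1 ⟨
    ∑V n (λ _ → 1)                                        ≡⟨ ∑-cong (allVecs n) (λ v → sym (one-fibre v)) ⟩
    ∑V n (λ v → ∑F (λ t₁ → ∑F (λ t₂ → fibre t₁ t₂ v)))    ≡⟨ ∑-swap (allVecs n) elems _ ⟩
    ∑F (λ t₁ → ∑V n (λ v → ∑F (λ t₂ → fibre t₁ t₂ v)))
      ≡⟨ ∑-cong elems (λ t₁ → ∑-swap (allVecs n) elems _) ⟩
    ∑F (λ t₁ → ∑F (λ t₂ → ∑V n (fibre t₁ t₂)))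
      ≡⟨ ∑-cong elems (λ t₁ → ∑-cong elems (λ t₂ → fibre-size a b u₁ u₂ au₁ bu₁ au₂ bu₂ t₁ t₂)) ⟩
    ∑F (λ t₁ → ∑F (λ t₂ → commonZeros a b))               ≡⟨ ∑-cong elems (λ t₁ → ∑F-const _) ⟩
    ∑F (λ t₁ → q N.* commonZeros a b)                     ≡⟨ ∑F-const _ ⟩
    q N.* (q N.* commonZeros a b)                         ∎
    where
    fibre : Carrier → Carrier → Vec Carrier n → ℕ
    fibre t₁ t₂ v = δ (t₁ ≟ dot a v) N.* δ (t₂ ≟ dot b v)
    one-fibre : ∀ v → ∑F (λ t₁ → ∑F (λ t₂ → fibre t₁ t₂ v)) ≡ 1
    one-fibre v = begin
      ∑F (λ t₁ → ∑F (λ t₂ → fibre t₁ t₂ v))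
        ≡⟨ ∑-cong elems (λ t₁ → ∑-*ˡ elems (δ (t₁ ≟ dot a v)) _) ⟩
      ∑F (λ t₁ → δ (t₁ ≟ dot a v) N.* ∑F (λ t₂ → δ (t₂ ≟ dot b v)))
        ≡⟨ ∑-cong elems (λ t₁ → cong (δ (t₁ ≟ dot a v) N.*_) (∑F-count-one (dot b v))) ⟩
      ∑F (λ t₁ → δ (t₁ ≟ dot a v) N.* 1)                  ≡⟨ ∑F-sift (dot a v) (λ _ → 1) ⟩
      1                                                   ∎

-- Sums over Fⁿ regrouped along the points of projective space: every nonzero
-- vector is c·P for exactly one nonzero c and one normalised P.
module ProjectiveSums (F : FiniteField) where
  open FiniteField F
  open PG4 F using (allVecs; normalized)
  open Linear F
  open Normalisation F using (normalise; normalise-unique)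
  open FieldSums F
  open ListSums
  open import Data.Nat as N using (ℕ)
  import Data.Nat.Properties as NP
  open import Data.Nat.Tactic.RingSolver using (solve-∀)
  open import Data.Bool using (true; false)
  open import Data.Vec using (Vec)
  open import Data.Product using (_,_)
  open import Relation.Binary.PropositionalEquality
  open import Relation.Nullary using (yes; no)
  open import Data.Empty using (⊥-elim)
  open ≡-Reasoning

  count-representations : ∀ {n} (v : Vec Carrier n) → v ≢ 0V n →
    ∑F (λ c → ∑V n (λ P → nonzero c N.* (𝟙 (normalized P) N.* δ (v ≟V c ·V P)))) ≡ 1
  count-representations {n} v v≢0 with normalise v v≢0
  ... | c₀ , P₀ , c₀≢0 , nP₀ , v≡c₀P₀ = begin
    ∑F (λ c → ∑V n (λ P → nonzero c N.* (𝟙 (normalized P) N.* δ (v ≟V c ·V P))))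
      ≡⟨ ∑-cong elems (λ c → ∑-cong (allVecs n) (λ P → is-representation c P)) ⟩
    ∑F (λ c → ∑V n (λ P → δ (c ≟ c₀) N.* (δ (P ≟V P₀) N.* 1)))
      ≡⟨ ∑-cong elems (λ c → ∑-*ˡ (allVecs n) (δ (c ≟ c₀)) _) ⟩
    ∑F (λ c → δ (c ≟ c₀) N.* ∑V n (λ P → δ (P ≟V P₀) N.* 1))
      ≡⟨ ∑-cong elems (λ c → cong (δ (c ≟ c₀) N.*_) (∑V-sift n P₀ (λ _ → 1))) ⟩
    ∑F (λ c → δ (c ≟ c₀) N.* 1)
      ≡⟨ ∑F-sift c₀ (λ _ → 1) ⟩
    1 ∎
    where
    is-representation : ∀ c P →
      nonzero c N.* (𝟙 (normalized P) N.* δ (v ≟V c ·V P)) ≡ δ (c ≟ c₀) N.* (δ (P ≟V P₀) N.* 1)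
    is-representation c P with c ≟ 0# | normalized P in nP | v ≟V c ·V P | c ≟ c₀ | P ≟V P₀
    ... | yes c≡0 | _     | _        | yes c≡c₀ | _        = ⊥-elim (c₀≢0 (trans (sym c≡c₀) c≡0))
    ... | yes _   | _     | _        | no _     | _        = refl
    ... | no _    | false | _        | yes _    | yes refl = ⊥-elim (false≢true (trans (sym nP) nP₀))
      where
      false≢true : false ≢ true
      false≢true ()
    ... | no _    | false | _        | yes _    | no _     = refl
    ... | no _    | false | _        | no _     | _        = refl
    ... | no _    | true  | no v≢cP  | yes refl | yes refl = ⊥-elim (v≢cP v≡c₀P₀)
    ... | no _    | true  | no _     | yes _    | no _     = refl
    ... | no _    | true  | no _     | no _     | _        = refl
    ... | no c≢0  | true  | yes v≡cP | c≟c₀     | P≟P₀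
        with normalise-unique c c₀ P P₀ c≢0 c₀≢0 nP nP₀ (trans (sym v≡cP) v≡c₀P₀)
    ...   | c≡c₀ , P≡P₀ = sym (cong₂ N._*_ (δ-yes c≟c₀ c≡c₀) (cong (N._* 1) (δ-yes P≟P₀ P≡P₀)))

  ∑V-projective : ∀ n (g : Vec Carrier n → ℕ) → (∀ c P → c ≢ 0# → g (c ·V P) ≡ g P) → g (0V n) ≡ 0 →
    ∑F nonzero N.* ∑V n (λ P → 𝟙 (normalized P) N.* g P) ≡ ∑V n g
  ∑V-projective n g g-scale g-0 = begin
    ∑F nonzero N.* ∑V n (λ P → 𝟙 (normalized P) N.* g P)
      ≡⟨ ∑-*ʳ elems _ nonzero ⟨
    ∑F (λ c → nonzero c N.* ∑V n (λ P → 𝟙 (normalized P) N.* g P))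
      ≡⟨ ∑-cong elems (λ c → sym (∑-*ˡ (allVecs n) (nonzero c) _)) ⟩
    ∑F (λ c → ∑V n (λ P → nonzero c N.* (𝟙 (normalized P) N.* g P)))
      ≡⟨ ∑-cong elems (λ c → ∑-cong (allVecs n) (λ P → scale c P)) ⟩
    ∑F (λ c → ∑V n (λ P → nonzero c N.* (𝟙 (normalized P) N.* g (c ·V P))))
      ≡⟨ ∑-cong elems (λ c → ∑-cong (allVecs n) (λ P → unsift c P)) ⟩
    ∑F (λ c → ∑V n (λ P → ∑V n (λ v → term c P v N.* g v)))
      ≡⟨ ∑-cong elems (λ c → ∑-swap (allVecs n) (allVecs n) _) ⟩
    ∑F (λ c → ∑V n (λ v → ∑V n (λ P → term c P v N.* g v)))
      ≡⟨ ∑-swap elems (allVecs n) _ ⟩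
    ∑V n (λ v → ∑F (λ c → ∑V n (λ P → term c P v N.* g v)))
      ≡⟨ ∑-cong (allVecs n) (λ v → trans (∑-cong elems (λ c → ∑-*ʳ (allVecs n) (g v) _)) (∑-*ʳ elems (g v) _)) ⟩
    ∑V n (λ v → ∑F (λ c → ∑V n (λ P → term c P v)) N.* g v)
      ≡⟨ ∑-cong (allVecs n) collapse ⟩
    ∑V n g ∎
    where
    term : Carrier → Vec Carrier n → Vec Carrier n → ℕ
    term c P v = nonzero c N.* (𝟙 (normalized P) N.* δ (v ≟V c ·V P))
    scale : ∀ c P → nonzero c N.* (𝟙 (normalized P) N.* g P) ≡ nonzero c N.* (𝟙 (normalized P) N.* g (c ·V P))
    scale c P with c ≟ 0#
    ... | yes _  = refl
    ... | no c≢0 = cong (λ z → 1 N.* (𝟙 (normalized P) N.* z)) (sym (g-scale c P c≢0))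
    reassociate : ∀ a b c d → a N.* (b N.* (c N.* d)) ≡ a N.* (b N.* c) N.* d
    reassociate = solve-∀
    unsift : ∀ c P → nonzero c N.* (𝟙 (normalized P) N.* g (c ·V P)) ≡ ∑V n (λ v → term c P v N.* g v)
    unsift c P = begin
      nonzero c N.* (𝟙 (normalized P) N.* g (c ·V P))
        ≡⟨ cong (λ z → nonzero c N.* (𝟙 (normalized P) N.* z)) (∑V-sift n (c ·V P) g) ⟨
      nonzero c N.* (𝟙 (normalized P) N.* ∑V n (λ v → δ (v ≟V c ·V P) N.* g v))
        ≡⟨ cong (nonzero c N.*_) (∑-*ˡ (allVecs n) (𝟙 (normalized P)) _) ⟨
      nonzero c N.* ∑V n (λ v → 𝟙 (normalized P) N.* (δ (v ≟V c ·V P) N.* g v))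
        ≡⟨ ∑-*ˡ (allVecs n) (nonzero c) _ ⟨
      ∑V n (λ v → nonzero c N.* (𝟙 (normalized P) N.* (δ (v ≟V c ·V P) N.* g v)))
        ≡⟨ ∑-cong (allVecs n) (λ v → reassociate (nonzero c) (𝟙 (normalized P)) (δ (v ≟V c ·V P)) (g v)) ⟩
      ∑V n (λ v → term c P v N.* g v) ∎
    -- the zero vector contributes g 0 = 0, any other vector g v once
    collapse : ∀ v → ∑F (λ c → ∑V n (λ P → term c P v)) N.* g v ≡ g v
    collapse v with v ≟V 0V n
    ... | yes refl = trans (cong (∑F (λ c → ∑V n (λ P → term c P (0V n))) N.*_) g-0)
                           (trans (NP.*-zeroʳ (∑F (λ c → ∑V n (λ P → term c P (0V n))))) (sym g-0))
    ... | no v≢0   = trans (cong (N._* g v) (count-representations v v≢0)) (NP.*-identityˡ (g v))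

-- The degree of a vector w is the number of solids of ℰ through it
-- (PG4.pointDeg, defined for all vectors).
module Degrees (F : FiniteField) (E : PG4.SolidSet F) where
  open FiniteField F
  open PG4 F
  open Linear F
  open FieldSums F
  open ListSums
  open import Data.Nat as N using (ℕ)
  import Data.Nat.Properties as NP
  open import Data.Nat.DivMod using (_/_)
  open import Data.Bool using (Bool; T; true; false; _∧_)
  open import Data.Bool.Properties using (∧-identityʳ)
  open import Function.Base using (_∘_)
  open import Data.List using (length; filterᵇ)
  open import Data.List.Membership.Propositional using (_∈_)
  open import Data.List.Membership.Propositional.Properties using (∈-filter⁺; ∈-filter⁻)
  open import Data.Bool.Properties using (T-≡; T-∧)
  open import Data.Product using (_×_; _,_; proj₂)
  open import Function.Bundles using (Equivalence)
  open import Relation.Binary.PropositionalEquality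
  open import Relation.Nullary.Decidable using (T?; isYes≗does)
  open ≡-Reasoning

  blackDegree : ℕ
  blackDegree = (q N.^ 3 N.∸ q N.^ 2) / 2

  pointDeg-as-sum : ∀ w → pointDeg E w ≡ ∑ solids (λ s → 𝟙 (E s ∧ onSolid s w))
  pointDeg-as-sum w = length-filter solids (λ s → E s ∧ onSolid s w)

  size-as-sum : size E ≡ ∑ solids (λ s → 𝟙 (E s))
  size-as-sum = length-filter solids E

  onSolid-scale : ∀ s c w → c ≢ 0# → onSolid s (c ·V w) ≡ onSolid s w
  onSolid-scale s c w c≢0 = trans (cong isZero (dot-· s c w)) (isZero-* c (dot s w) c≢0)

  pointDeg-scale : ∀ c w → c ≢ 0# → pointDeg E (c ·V w) ≡ pointDeg E w
  pointDeg-scale c w c≢0 = begin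
    pointDeg E (c ·V w)                        ≡⟨ pointDeg-as-sum (c ·V w) ⟩
    ∑ solids (λ s → 𝟙 (E s ∧ onSolid s (c ·V w)))
      ≡⟨ ∑-cong solids (λ s → cong (λ b → 𝟙 (E s ∧ b)) (onSolid-scale s c w c≢0)) ⟩
    ∑ solids (λ s → 𝟙 (E s ∧ onSolid s w))        ≡⟨ pointDeg-as-sum w ⟨
    pointDeg E w                               ∎

  -- Every solid contains the zero vector.
  pointDeg-0V : pointDeg E (0V 5) ≡ size E
  pointDeg-0V = begin
    pointDeg E (0V 5)                           ≡⟨ pointDeg-as-sum (0V 5) ⟩
    ∑ solids (λ s → 𝟙 (E s ∧ onSolid s (0V 5))) ≡⟨ ∑-cong solids (λ s → cong 𝟙 (through-0 s)) ⟩
    ∑ solids (λ s → 𝟙 (E s))                    ≡⟨ size-as-sum ⟨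
    size E                                      ∎
    where
    through-0 : ∀ s → E s ∧ onSolid s (0V 5) ≡ E s
    through-0 s = trans (cong (E s ∧_) (isZero-true _ (dot-0ʳ s))) (∧-identityʳ (E s))

  normalized⇒point : ∀ P → normalized P ≡ true → P ∈ points
  normalized⇒point P nP =
    ∈-filter⁺ {P = T ∘ normalized} (T? ∘ normalized) (allVecs-complete 5 P) (Equivalence.from T-≡ nP)

  point⇒normalized : ∀ {P} → P ∈ points → normalized P ≡ true
  point⇒normalized P∈ =
    Equivalence.to T-≡ (proj₂ (∈-filter⁻ {P = T ∘ normalized} (T? ∘ normalized) {xs = allVecs 5} P∈))

  planePoint⇒ : ∀ a b {P} → P ∈ planePoints a b → normalized P ≡ true × dot a P ≡ 0# × dot b P ≡ 0#
  planePoint⇒ a b P∈ with ∈-filter⁻ {P = T ∘ onPlane} (T? ∘ onPlane) {xs = points} P∈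
    where
    onPlane : Vec5 → Bool
    onPlane P = onSolid a P ∧ onSolid b P
  ... | P∈points , on with Equivalence.to T-∧ on
  ...   | on-a , on-b = point⇒normalized P∈points ,
                        isZero-true⁻ _ (Equivalence.to T-≡ on-a) , isZero-true⁻ _ (Equivalence.to T-≡ on-b)

  𝟙-onSolid : ∀ s w → 𝟙 (onSolid s w) ≡ δ (dot s w ≟ 0#)
  𝟙-onSolid s w = cong 𝟙 (isYes≗does (dot s w ≟ 0#))

  blackPointsOnPlane-as-sum : ∀ a b d → blackDegree ≡ d → blackPointsOnPlane E a b ≡
    ∑V 5 (λ P → 𝟙 (normalized P) N.* (𝟙 (onSolid a P ∧ onSolid b P) N.* δ (pointDeg E P N.≟ d)))
  blackPointsOnPlane-as-sum a b _ refl = begin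
    length (filterᵇ (isBlackᵇ E) (filterᵇ onPlane points))       ≡⟨ length-filter (filterᵇ onPlane points) _ ⟩
    ∑ (filterᵇ onPlane points) (λ P → 𝟙 (isBlackᵇ E P))          ≡⟨ ∑-filter points onPlane _ ⟩
    ∑ points (λ P → 𝟙 (onPlane P) N.* 𝟙 (isBlackᵇ E P))          ≡⟨ ∑-filter (allVecs 5) normalized _ ⟩
    ∑V 5 (λ P → 𝟙 (normalized P) N.* (𝟙 (onPlane P) N.* 𝟙 (isBlackᵇ E P))) ∎
    where
    onPlane : Vec5 → Bool
    onPlane P = onSolid a P ∧ onSolid b P

  red-off : ∀ R → pointDeg E R ≡ 0 → ∀ {s} → s ∈ solids → E s ≡ true → dot s R ≢ 0#
  red-off R red {s} s∈ Es sR≡0 = NP.1+n≢0 (begin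
    1                       ≡⟨ cong₂ (λ x y → 𝟙 (x ∧ y)) Es (isZero-true (dot s R) sR≡0) ⟨
    𝟙 (E s ∧ onSolid s R)   ≡⟨ ∑-zero⁻ solids _ (trans (sym (pointDeg-as-sum R)) red) s∈ ⟩
    0                       ∎)

  -- If no solid of ℰ contains the direction R, each solid of ℰ meets the
  -- affine line v + F·R in exactly one vector, so the degrees along the line
  -- sum to |ℰ|.
  line-sum : ∀ R → (∀ {s} → s ∈ solids → E s ≡ true → dot s R ≢ 0#) →
    ∀ v → ∑F (λ l → pointDeg E (v +V l ·V R)) ≡ size E
  line-sum R off v = begin
    ∑F (λ l → pointDeg E (v +V l ·V R))                      ≡⟨ ∑-cong elems (λ l → pointDeg-as-sum _) ⟩
    ∑F (λ l → ∑ solids (λ s → 𝟙 (E s ∧ onSolid s (v +V l ·V R)))) ≡⟨ ∑-swap elems solids _ ⟩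
    ∑ solids (λ s → ∑F (λ l → 𝟙 (E s ∧ onSolid s (v +V l ·V R)))) ≡⟨ ∑-cong-∈ solids meets-once ⟩
    ∑ solids (λ s → 𝟙 (E s))                                 ≡⟨ size-as-sum ⟨
    size E                                                   ∎
    where
    meets-once : ∀ {s} → s ∈ solids → ∑F (λ l → 𝟙 (E s ∧ onSolid s (v +V l ·V R))) ≡ 𝟙 (E s)
    meets-once {s} s∈ with E s in Es
    ... | false = ∑-zero elems _ (λ _ → refl)
    ... | true  = begin
      ∑F (λ l → 𝟙 (onSolid s (v +V l ·V R)))         ≡⟨ ∑-cong elems (λ l → 𝟙-onSolid s _) ⟩
      ∑F (λ l → δ (dot s (v +V l ·V R) ≟ 0#))
        ≡⟨ ∑-cong elems (λ l → cong (λ z → δ (z ≟ 0#)) (expand l)) ⟩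
      ∑F (λ l → δ ((dot s v + l * dot s R) ≟ 0#))    ≡⟨ count-root (dot s v) (dot s R) (off s∈ Es) ⟩
      1                                              ∎
      where
      expand : ∀ l → dot s (v +V l ·V R) ≡ dot s v + l * dot s R
      expand l = trans (dot-+ s v (l ·V R)) (cong (dot s v +_) (dot-· s l R))

module RedPoint (F : FiniteField) where
  open FiniteField F
  open PG4 F
  open Linear F
  open Normalisation F using (normalise; ·V-injectiveˡ)
  open FieldSums F
  open ProjectiveSums F using (∑V-projective)
  open ListSums
  open Arithmetic using (unique-black; solve-count)
  open import Data.Nat as N using (ℕ; zero; suc; z≤n; s≤s)
  import Data.Nat.Properties as NP
  open import Data.Nat.Tactic.RingSolver using (solve-∀)
  open import Data.Bool using (true; _∧_)
  open import Data.List.Membership.Propositional using (_∈_)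
  open import Data.Sum using (_⊎_; inj₁; inj₂)
  open import Data.Product using (_,_)
  open import Relation.Binary.PropositionalEquality
  open import Relation.Nullary using (Dec; yes; no)
  open import Data.Empty using (⊥-elim)
  open ≡-Reasoning

  one-black-value : ∀ K m → 1 N.≤ K → 1 N.≤ m → q ≡ suc m → (f : Carrier → ℕ) →
    (∀ l → f l ≡ 0 ⊎ f l ≡ K N.* q ⊎ f l ≡ K N.* m) → ∑F f ≡ K N.* (m N.* (q N.+ 1)) →
    ∑F (λ l → δ (f l N.≟ K N.* m)) ≡ 1
  one-black-value (suc K') m (s≤s z≤n) m≥1 q≡1+m f values total =
    unique-black x y m m≥1 x+y≤q (subst (λ z → x N.* z N.+ y N.* m ≡ m N.* (z N.+ 1)) q≡1+m line-equation)
    where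
    K A B : ℕ
    K = suc K'
    A = K N.* q
    B = K N.* m
    A≢B : A ≢ B
    A≢B e = NP.1+n≢n (trans (sym q≡1+m) (NP.*-cancelˡ-≡ q m K e))
    x y : ℕ
    x = ∑F (λ l → δ (f l N.≟ A))
    y = ∑F (λ l → δ (f l N.≟ B))
    -- (stated for arbitrary decisions, so that δ computes on yes/no)
    classify : ∀ n (dA : Dec (n ≡ A)) (dB : Dec (n ≡ B)) → n ≡ 0 ⊎ n ≡ A ⊎ n ≡ B →
      n ≡ δ dA N.* A N.+ δ dB N.* B
    classify n (yes eA) (yes eB) _             = ⊥-elim (A≢B (trans (sym eA) eB))
    classify n (yes eA) (no _)   _             = trans eA (sym (trans (NP.+-identityʳ _) (NP.*-identityˡ A)))
    classify n (no _)   (yes eB) _             = trans eB (sym (NP.*-identityˡ B))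
    classify n (no _)   (no _)   (inj₁ e)        = e
    classify n (no ¬eA) (no _)   (inj₂ (inj₁ e)) = ⊥-elim (¬eA e)
    classify n (no _)   (no ¬eB) (inj₂ (inj₂ e)) = ⊥-elim (¬eB e)
    at-most-one : ∀ n (dA : Dec (n ≡ A)) (dB : Dec (n ≡ B)) → δ dA N.+ δ dB N.≤ 1
    at-most-one n (yes eA) (yes eB) = ⊥-elim (A≢B (trans (sym eA) eB))
    at-most-one n (yes _)  (no _)   = s≤s z≤n
    at-most-one n (no _)   (yes _)  = s≤s z≤n
    at-most-one n (no _)   (no _)   = z≤n
    x+y≤q : x N.+ y N.≤ suc m
    x+y≤q = NP.≤-trans (NP.≤-reflexive (sym (∑-+ elems _ _)))
              (NP.≤-trans (∑-mono elems (λ l → at-most-one (f l) (f l N.≟ A) (f l N.≟ B)))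
                          (NP.≤-reflexive (trans ∑F-one q≡1+m)))
    factor : ∀ x y K q m → x N.* (K N.* q) N.+ y N.* (K N.* m) ≡ K N.* (x N.* q N.+ y N.* m)
    factor = solve-∀
    line-equation : x N.* q N.+ y N.* m ≡ m N.* (q N.+ 1)
    line-equation = NP.*-cancelˡ-≡ _ _ K (begin
      K N.* (x N.* q N.+ y N.* m)    ≡⟨ factor x y K q m ⟨
      x N.* A N.+ y N.* B            ≡⟨ cong₂ N._+_ (∑-*ʳ elems A _) (∑-*ʳ elems B _) ⟨
      ∑F (λ l → δ (f l N.≟ A) N.* A) N.+ ∑F (λ l → δ (f l N.≟ B) N.* B) ≡⟨ ∑-+ elems _ _ ⟨
      ∑F (λ l → δ (f l N.≟ A) N.* A N.+ δ (f l N.≟ B) N.* B)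
        ≡⟨ ∑-cong elems (λ l → classify (f l) (f l N.≟ A) (f l N.≟ B) (values l)) ⟨
      ∑F f                           ≡⟨ total ⟩
      K N.* (m N.* (q N.+ 1))        ∎)

  module _ (E : SolidSet) (K m : ℕ) (K≥1 : 1 N.≤ K) (m≥1 : 1 N.≤ m) (q≡1+m : q ≡ suc m)
    (degrees : ∀ P → P ∈ points → pointDeg E P ≡ 0 ⊎ pointDeg E P ≡ K N.* q ⊎ pointDeg E P ≡ K N.* m)
    (|ℰ| : size E ≡ K N.* (m N.* (q N.+ 1)))
    (R : Vec5) (nR : normalized R ≡ true) (red : pointDeg E R ≡ 0) where
    open Degrees F E

    -- black vectors: nonzero multiples of black points
    black : Vec5 → ℕ
    black w = δ (pointDeg E w N.≟ K N.* m)

    blackOnLine : Vec5 → ℕ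
    blackOnLine v = ∑F (λ l → black (v +V l ·V R))

    onSpan : Vec5 → ℕ
    onSpan v = ∑F (λ μ → δ (v ≟V μ ·V R))

    Km≢0 : K N.* m ≢ 0
    Km≢0 e with NP.m*n≡0⇒m≡0∨n≡0 K e
    ... | inj₁ K≡0 = NP.<⇒≢ K≥1 (sym K≡0)
    ... | inj₂ m≡0 = NP.<⇒≢ m≥1 (sym m≡0)

    |ℰ|≢Km : K N.* (m N.* (q N.+ 1)) ≢ K N.* m
    |ℰ|≢Km e = NP.1+n≢0 (trans (sym q≡1+m) (NP.+-cancelʳ-≡ 1 q 0 q+1≡1))
      where
      q+1≡1 : q N.+ 1 ≡ 1
      q+1≡1 = NP.*-cancelˡ-≡ (q N.+ 1) 1 m {{N.>-nonZero m≥1}}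
                (trans (NP.*-cancelˡ-≡ _ _ K {{N.>-nonZero K≥1}} e) (sym (NP.*-identityʳ m)))

    black-0V : black (0V 5) ≡ 0
    black-0V = δ-no (pointDeg E (0V 5) N.≟ K N.* m) (λ e → |ℰ|≢Km (trans (sym |ℰ|) (trans (sym pointDeg-0V) e)))

    -- No vector of the span of R is black: nonzero ones have degree 0.
    black-span : ∀ μ → black (μ ·V R) ≡ 0
    black-span μ with μ ≟ 0#
    ... | yes refl = trans (cong black (·V-zero R)) black-0V
    ... | no μ≢0   = δ-no (pointDeg E (μ ·V R) N.≟ K N.* m)
                          (λ e → Km≢0 (trans (sym e) (trans (pointDeg-scale μ R μ≢0) red)))

    onSpan-span : ∀ μ₀ → onSpan (μ₀ ·V R) ≡ 1
    onSpan-span μ₀ = trans (∑-cong elems (λ μ → δ-iff (λ e → sym (·V-injectiveˡ R nR μ₀ μ e))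
                                                     (λ e → cong (_·V R) (sym e))
                                                     (μ₀ ·V R ≟V μ ·V R) (μ ≟ μ₀)))
                           (∑F-count-one μ₀)

    -- The key identity: the line through R and a vector v outside the span
    -- of R carries exactly one black point.
    line-through-red : ∀ v → blackOnLine v N.+ onSpan v ≡ 1
    line-through-red v with onSpan v in e
    ... | suc k with ∑-suc⁻ elems _ e
    ...   | μ₀ , j , e' with δ-suc⁻ (v ≟V μ₀ ·V R) e'
    ...     | refl = begin
      blackOnLine (μ₀ ·V R) N.+ suc k ≡⟨ cong₂ N._+_ (∑-zero elems _ no-black) (sym e) ⟩
      0 N.+ onSpan (μ₀ ·V R)          ≡⟨ onSpan-span μ₀ ⟩
      1                               ∎
      where
      no-black : ∀ l → black (μ₀ ·V R +V l ·V R) ≡ 0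
      no-black l = trans (cong black (·V-distrib μ₀ l R)) (black-span (μ₀ + l))
    line-through-red v | zero =
      trans (NP.+-identityʳ _) (one-black-value K m K≥1 m≥1 q≡1+m f admissible (trans (line-sum R off v) |ℰ|))
      where
      f : Carrier → ℕ
      f l = pointDeg E (v +V l ·V R)
      off : ∀ {s} → s ∈ solids → E s ≡ true → dot s R ≢ 0#
      off = red-off R red
      outside : ∀ μ → v ≢ μ ·V R
      outside μ = δ-zero⁻ (v ≟V μ ·V R) (∑-zero⁻ elems _ e (complete μ))
      -- v + l·R is a nonzero multiple of a point, whose degree is admissible
      admissible : ∀ l → f l ≡ 0 ⊎ f l ≡ K N.* q ⊎ f l ≡ K N.* m
      admissible l with normalise (v +V l ·V R) (λ e → outside (- l) (+V-solve v R l e))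
      ... | c , P , c≢0 , nP , v+lR≡cP rewrite v+lR≡cP | pointDeg-scale c P c≢0 =
        degrees P (normalized⇒point P nP)

    module _ (a b : Vec5) (na : normalized a ≡ true) (nb : normalized b ≡ true) (a≢b : a ≢ b)
      (aR≡0 : dot a R ≡ 0#) (bR≡0 : dot b R ≡ 0#) where

      inPlane : Vec5 → ℕ
      inPlane v = 𝟙 (onSolid a v ∧ onSolid b v)

      blackVectors blackPoints : ℕ
      blackVectors = ∑V 5 (λ v → inPlane v N.* black v)
      blackPoints  = ∑V 5 (λ P → 𝟙 (normalized P) N.* (inPlane P N.* black P))

      instance
        q≢0 : N.NonZero q
        q≢0 = subst N.NonZero (sym q≡1+m) _

      plane-size : ∑V 5 inPlane ≡ q N.^ 3
      plane-size = NP.*-cancelˡ-≡ _ _ q (NP.*-cancelˡ-≡ _ _ q (begin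
        q N.* (q N.* ∑V 5 inPlane)         ≡⟨ cong (λ z → q N.* (q N.* z)) (∑-cong (allVecs 5) as-δ) ⟩
        q N.* (q N.* commonZeros a b)      ≡⟨ count-commonZeros a b na nb a≢b ⟨
        q N.^ 5                            ∎))
        where
        as-δ : ∀ v → inPlane v ≡ δ (dot a v ≟ 0#) N.* δ (dot b v ≟ 0#)
        as-δ v = trans (𝟙-∧ (onSolid a v) (onSolid b v)) (cong₂ N._*_ (𝟙-onSolid a v) (𝟙-onSolid b v))

      inPlane-shift : ∀ v l → inPlane (v +V l ·V R) ≡ inPlane v
      inPlane-shift v l = cong₂ (λ x y → 𝟙 (isZero x ∧ isZero y)) (shift a aR≡0) (shift b bR≡0)
        where
        shift : ∀ s → dot s R ≡ 0# → dot s (v +V l ·V R) ≡ dot s v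
        shift s sR≡0 = begin
          dot s (v +V l ·V R)        ≡⟨ dot-+ s v (l ·V R) ⟩
          dot s v + dot s (l ·V R)   ≡⟨ cong (dot s v +_) (trans (dot-· s l R) (cong (l *_) sR≡0)) ⟩
          dot s v + l * 0#           ≡⟨ cong (dot s v +_) (R.zeroʳ l) ⟩
          dot s v + 0#               ≡⟨ R.+-identityʳ (dot s v) ⟩
          dot s v                    ∎

      inPlane-span : ∀ μ → inPlane (μ ·V R) ≡ 1
      inPlane-span μ = cong₂ (λ x y → 𝟙 (x ∧ y)) (isZero-true _ (on a aR≡0)) (isZero-true _ (on b bR≡0))
        where
        on : ∀ s → dot s R ≡ 0# → dot s (μ ·V R) ≡ 0#
        on s sR≡0 = trans (dot-· s μ R) (trans (cong (μ *_) sR≡0) (R.zeroʳ μ))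

      -- Summing the black vectors over the lines v + F·R (v ∈ π) counts each
      -- black vector of π q times, since π is invariant under these shifts.
      count-by-lines : q N.* blackVectors ≡ ∑V 5 (λ v → inPlane v N.* blackOnLine v)
      count-by-lines = begin
        q N.* blackVectors                                        ≡⟨ ∑F-const blackVectors ⟨
        ∑F (λ l → blackVectors)
          ≡⟨ ∑-cong elems (λ l → sym (∑V-translate 5 (l ·V R) (λ w → inPlane w N.* black w))) ⟩
        ∑F (λ l → ∑V 5 (λ v → inPlane (v +V l ·V R) N.* black (v +V l ·V R)))
          ≡⟨ ∑-cong elems (λ l → ∑-cong (allVecs 5) (λ v → cong (N._* black (v +V l ·V R)) (inPlane-shift v l))) ⟩
        ∑F (λ l → ∑V 5 (λ v → inPlane v N.* black (v +V l ·V R))) ≡⟨ ∑-swap elems (allVecs 5) _ ⟩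
        ∑V 5 (λ v → ∑F (λ l → inPlane v N.* black (v +V l ·V R)))
          ≡⟨ ∑-cong (allVecs 5) (λ v → ∑-*ˡ elems (inPlane v) _) ⟩
        ∑V 5 (λ v → inPlane v N.* blackOnLine v)                  ∎

      span-size : ∑V 5 (λ v → inPlane v N.* onSpan v) ≡ q
      span-size = begin
        ∑V 5 (λ v → inPlane v N.* onSpan v)
          ≡⟨ ∑-cong (allVecs 5) (λ v → sym (∑-*ˡ elems (inPlane v) _)) ⟩
        ∑V 5 (λ v → ∑F (λ μ → inPlane v N.* δ (v ≟V μ ·V R))) ≡⟨ ∑-swap (allVecs 5) elems _ ⟩
        ∑F (λ μ → ∑V 5 (λ v → inPlane v N.* δ (v ≟V μ ·V R)))
          ≡⟨ ∑-cong elems (λ μ → trans (∑-cong (allVecs 5) (λ v → NP.*-comm (inPlane v) _))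
                                      (∑V-sift 5 (μ ·V R) inPlane)) ⟩
        ∑F (λ μ → inPlane (μ ·V R))                           ≡⟨ ∑-cong elems inPlane-span ⟩
        ∑F (λ _ → 1)                                          ≡⟨ ∑F-one ⟩
        q                                                     ∎

      -- Summing line-through-red over π: q³ = q·blackVectors + q.
      plane-equation : q N.^ 3 ≡ q N.* blackVectors N.+ q
      plane-equation = begin
        q N.^ 3                                           ≡⟨ plane-size ⟨
        ∑V 5 inPlane                                      ≡⟨ ∑-cong (allVecs 5) split ⟩
        ∑V 5 (λ v → inPlane v N.* blackOnLine v N.+ inPlane v N.* onSpan v) ≡⟨ ∑-+ (allVecs 5) _ _ ⟩
        ∑V 5 (λ v → inPlane v N.* blackOnLine v) N.+ ∑V 5 (λ v → inPlane v N.* onSpan v)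
          ≡⟨ cong₂ N._+_ (sym count-by-lines) span-size ⟩
        q N.* blackVectors N.+ q                          ∎
        where
        split : ∀ v → inPlane v ≡ inPlane v N.* blackOnLine v N.+ inPlane v N.* onSpan v
        split v = sym (trans (sym (NP.*-distribˡ-+ (inPlane v) (blackOnLine v) (onSpan v)))
                             (trans (cong (inPlane v N.*_) (line-through-red v)) (NP.*-identityʳ (inPlane v))))

      -- Every black point of π is spanned by q − 1 = m black vectors.
      vectors-by-points : blackVectors ≡ m N.* blackPoints
      vectors-by-points = begin
        blackVectors                        ≡⟨ ∑V-projective 5 (λ v → inPlane v N.* black v) scale-invariant zero-at-0 ⟨
        ∑F nonzero N.* blackPoints          ≡⟨ cong (N._* blackPoints) units ⟩
        m N.* blackPoints                   ∎
        where
        units : ∑F nonzero ≡ m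
        units = NP.+-cancelʳ-≡ 1 _ m (trans count-nonzero (trans q≡1+m (NP.+-comm 1 m)))
        scale-invariant : ∀ c P → c ≢ 0# → inPlane (c ·V P) N.* black (c ·V P) ≡ inPlane P N.* black P
        scale-invariant c P c≢0 = cong₂ N._*_
          (cong₂ (λ x y → 𝟙 (x ∧ y)) (onSolid-scale a c P c≢0) (onSolid-scale b c P c≢0))
          (cong (λ z → δ (z N.≟ K N.* m)) (pointDeg-scale c P c≢0))
        zero-at-0 : inPlane (0V 5) N.* black (0V 5) ≡ 0
        zero-at-0 = trans (cong (inPlane (0V 5) N.*_) black-0V) (NP.*-zeroʳ (inPlane (0V 5)))

      count-black-points : blackPoints ≡ q N.+ 1
      count-black-points = subst (λ z → blackPoints ≡ z N.+ 1) (sym q≡1+m)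
        (solve-count m blackVectors blackPoints m≥1
          (subst (λ z → z N.^ 3 ≡ z N.* blackVectors N.+ z) q≡1+m plane-equation) vectors-by-points)

open import Data.Nat using (ℕ; _+_; _*_; _∸_; _^_; _<_)
open import Data.Nat.DivMod using (_/_)
open import Data.Nat.Divisibility using (_∣_)
open import Data.Sum using (_⊎_)
open import Data.Product using (∃; _×_)
open import Data.List.Membership.Propositional using (_∈_)
open import Relation.Binary.PropositionalEquality using (_≡_; _≢_)

open import Data.Nat using (z≤n; s≤s)
open import Data.Nat.Properties using (<-trans)
open import Data.Product using (_,_; proj₁; proj₂)
open import Data.Sum using (map; map₂)
open import Data.Bool using (true)
open import Relation.Binary.PropositionalEquality using (trans)

lemma2p12 : (F : FiniteField) → let open PG4 F in
    2 < q → 2 ∣ q →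
    (E : SolidSet) →
    (∀ P → P ∈ points →
      pointDeg E P ≡ 0 ⊎ pointDeg E P ≡ (q ^ 3) / 2 ⊎ pointDeg E P ≡ (q ^ 3 ∸ q ^ 2) / 2) →
    (∀ a b → a ∈ solids → b ∈ solids → a ≢ b →
      planeDeg E a b ≡ 0 ⊎ planeDeg E a b ≡ q / 2 ⊎ planeDeg E a b ≡ q) →
    size E ≡ (q ^ 2 * (q ^ 2 ∸ 1)) / 2 →
    ∀ a b → a ∈ solids → b ∈ solids → a ≢ b →
    (∃ λ P → P ∈ planePoints a b × isRed E P) →
    blackPointsOnPlane E a b ≡ q + 1
lemma2p12 F 2<q 2∣q E degrees _ |ℰ| a b a∈solids b∈solids a≢b (R , R∈π , red) =
  trans (blackPointsOnPlane-as-sum a b (K * m) half-q³-q²)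
        (count-black-points E K m K≥1 m≥1 q≡1+m degrees′ (trans |ℰ| half-size) R nR red
          a b (point⇒normalized a∈solids) (point⇒normalized b∈solids) a≢b aR≡0 bR≡0)
  where
  open PG4 F
  open Degrees F E using (blackPointsOnPlane-as-sum; point⇒normalized; planePoint⇒)
  open RedPoint F using (count-black-points)
  open Arithmetic.Parameters (Arithmetic.parameters q (<-trans (s≤s z≤n) 2<q) 2∣q)
  degrees′ : ∀ P → P ∈ points → pointDeg E P ≡ 0 ⊎ pointDeg E P ≡ K * q ⊎ pointDeg E P ≡ K * m
  degrees′ P P∈ = map₂ (map (λ e → trans e half-q³) (λ e → trans e half-q³-q²)) (degrees P P∈)
  nR : normalized R ≡ true
  nR = proj₁ (planePoint⇒ a b R∈π)
  aR≡0 : dot a R ≡ FiniteField.0# F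
  aR≡0 = proj₁ (proj₂ (planePoint⇒ a b R∈π))
  bR≡0 : dot b R ≡ FiniteField.0# F
  bR≡0 = proj₂ (proj₂ (planePoint⇒ a b R∈π))
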